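{- Let $(D,X,H)$ be a minimal uncolorable degree-feasible configuration, let $v\in V(D)$, and let $T$ be an acyclic transversal of $(X',H')=(X,H)/v$. Then: (a) for every $x\in X_v$, $|N_H^+(x)\cap T|=1$ and $|N_H^-(x)\cap T|=1$; (b) if $u\in N_D^+(v)$ and $X_u\cap T=\{x_u\}$, then there is $x\in X_v$ with $xx_u\in A(H)$, and $N_H^-(x_u)\cap T=\emptyset$; (c) if $w\in N_D^-(v)$ and $X_w\cap T=\{x_w\}$, then there is $x\in X_v$ with $x_wx\in A(H)$, and $N_H^+(x_w)\cap T=\emptyset$.
   Context: Digraphs are finite, without loops and parallel arcs (opposite arcs allowed); connectivity means weak connectivity. $N^+$, $N^-$ denote out- and in-neighborhoods. A cover of a digraph $D$ is a pair $(X,H)$: pairwise disjoint sets $X_v$ ($v\in V(D)$), and a digraph $H$ on $\bigcup_v X_v$ with each $X_v$ independent, such that for each arc $uv\in A(D)$ the arcs of $H$ from $X_u$ to $X_v$ form a (possibly empty) matching and every arc of $H$ arises in this way. A feasible configuration is a triple $(D,X,H)$ with $D$ connected and $(X,H)$ a cover of $D$; degree-feasible means $|X_v|\ge\max\{d_D^+(v),d_D^-(v)\}$ for all $v$. An acyclic transversal is a set $T\subseteq V(H)$ with $|T\cap X_v|=1$ for all $v$ and $H[T]$ containing no directed cycle; the configuration is colorable if one exists, uncolorable otherwise, and minimal uncolorable if uncolorable but $(D,X,H-a)$ is colorable for every arc $a\in A(H)$. For $v\in V(D)$, $(X,H)/v$ denotes the cover $(X',H')$ of $D-v$ with $X'$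 the restriction of $X$ to $V(D)\setminus\{v\}$ and $H'=H-X_v$. -}

module Defs where

open import Data.Nat using (ℕ; zero; suc; _+_; _≤_)
open import Data.Fin using (Fin; zero; suc; _≟_)
open import Data.Bool using (Bool; true; false; _∧_; not; if_then_else_)
open import Data.Product using (Σ; _×_; _,_)
open import Function using (_∘_)
open import Relation.Binary.PropositionalEquality using (_≡_; _≢_)
open import Relation.Nullary using (¬_)
open import Relation.Nullary.Decidable using (⌊_⌋)

count : ∀ {k} → (Fin k → Bool) → ℕ
count {zero} f = 0
count {suc k} f = (if f zero then 1 else 0) + count (f ∘ suc)

-- a finite digraph on vertex set Fin n: no loops, no parallel arcs
-- (arc relation is boolean), opposite arcs allowed
record Digraph (n : ℕ) : Set where
  field
    arc      : Fin n → Fin n → Bool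
    loopless : ∀ v → arc v v ≡ false
open Digraph public

outdeg : ∀ {n} → Digraph n → Fin n → ℕ
outdeg D v = count (λ u → arc D v u)

indeg : ∀ {n} → Digraph n → Fin n → ℕ
indeg D v = count (λ u → arc D u v)

data WReach {n} (D : Digraph n) : Fin n → Fin n → Set where
  here : ∀ {u} → WReach D u u
  fwd  : ∀ {u w v} → arc D u w ≡ true → WReach D w v → WReach D u v
  bwd  : ∀ {u w v} → arc D w u ≡ true → WReach D w v → WReach D u v

Connected : ∀ {n} → Digraph n → Set
Connected D = ∀ u v → WReach D u v

-- A cover (X,H) of D: V(H) = Fin m, and p x = v means x ∈ X_v.
-- (So the X_v are pairwise disjoint and their union is V(H).)
record IsCover {n m} (D : Digraph n) (p : Fin m → Fin n) (H : Digraph m) : Set where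
  field
    independent : ∀ x y → arc H x y ≡ true → p x ≢ p y
    arises      : ∀ x y → arc H x y ≡ true → arc D (p x) (p y) ≡ true
    matchingOut : ∀ x y y' → arc H x y ≡ true → arc H x y' ≡ true → p y ≡ p y' → y ≡ y'
    matchingIn  : ∀ x x' y → arc H x y ≡ true → arc H x' y ≡ true → p x ≡ p x' → x ≡ x'

fibreSize : ∀ {n m} → (Fin m → Fin n) → Fin n → ℕ
fibreSize p v = count (λ x → ⌊ p x ≟ v ⌋)

DegreeFeasible : ∀ {n m} → Digraph n → (Fin m → Fin n) → Set
DegreeFeasible D p = ∀ v → (outdeg D v ≤ fibreSize p v) × (indeg D v ≤ fibreSize p v)

data TWalk {m} (H : Digraph m) (T : Fin m → Bool) : Fin m → Fin m → Set where
  step : ∀ {x y} → T x ≡ true → T y ≡ true → arc H x y ≡ true → TWalk H T x y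
  cons : ∀ {x y z} → T x ≡ true → arc H x y ≡ true → TWalk H T y z → TWalk H T x z

AcyclicIn : ∀ {m} → Digraph m → (Fin m → Bool) → Set
AcyclicIn H T = ∀ x → ¬ TWalk H T x x

record AcyclicTransversalOn {n m} (S : Fin n → Bool) (p : Fin m → Fin n)
         (H : Digraph m) (T : Fin m → Bool) : Set where
  field
    inS     : ∀ x → T x ≡ true → S (p x) ≡ true
    one     : ∀ u → S u ≡ true → count (λ x → T x ∧ ⌊ p x ≟ u ⌋) ≡ 1
    acyclic : AcyclicIn H T

allV : ∀ {n} → Fin n → Bool
allV _ = true

minusV : ∀ {n} → Fin n → Fin n → Bool
minusV v u = not ⌊ u ≟ v ⌋

AcyclicTransversal : ∀ {n m} → (Fin m → Fin n) → Digraph m → (Fin m → Bool) → Set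
AcyclicTransversal = AcyclicTransversalOn allV

-- acyclic transversal of (X,H)/v  (H' = H - X_v; since T avoids X_v, H'[T] = H[T])
AcyclicTransversalQuot : ∀ {n m} → (Fin m → Fin n) → Digraph m → Fin n → (Fin m → Bool) → Set
AcyclicTransversalQuot p H v = AcyclicTransversalOn (minusV v) p H

Colorable : ∀ {n m} → (Fin m → Fin n) → Digraph m → Set
Colorable p H = Σ _ λ T → AcyclicTransversal p H T

removeArc : ∀ {m} → Digraph m → Fin m → Fin m → Digraph m
removeArc H a b = record
  { arc = λ x y → arc H x y ∧ not (⌊ x ≟ a ⌋ ∧ ⌊ y ≟ b ⌋)
  ; loopless = lem }
  where
  lem : ∀ x → (arc H x x ∧ not (⌊ x ≟ a ⌋ ∧ ⌊ x ≟ b ⌋)) ≡ false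
  lem x with arc H x x | loopless H x
  ... | .false | Relation.Binary.PropositionalEquality.refl = Relation.Binary.PropositionalEquality.refl

-- minimal uncolorable configuration (D is carried implicitly through p's codomain)
record MinimalUncolorable {n m} (p : Fin m → Fin n) (H : Digraph m) : Set where
  field
    uncolorable : ¬ Colorable p H
    minimal     : ∀ a b → arc H a b ≡ true → Colorable p (removeArc H a b)

module Submission where

open import Defs
open import Data.Fin using (Fin)
open import Data.Bool using (Bool; true; false; _∧_)
open import Data.Product using (Σ; _×_)
open import Relation.Binary.PropositionalEquality using (_≡_)

import Data.Nat.Properties as ℕₚ
open import Algebra.Properties.CommutativeMonoid.Sum ℕₚ.+-0-commutativeMonoid
  using (sum; ∑-comm; sum-cong-≗)
open import Data.Bool using (_∨_; not; if_then_else_)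
open import Data.Bool.Properties using (¬-not; ∧-zeroʳ; ∨-zeroʳ)
open import Data.Empty using (⊥-elim)
open import Data.Fin using (zero; suc; _≟_)
open import Data.Fin.Properties using (suc-injective)
open import Data.Nat using (ℕ; zero; suc; _+_; _≤_; z≤n; s≤s)
open import Data.Nat.Properties
  using (≤-reflexive; ≤-trans; ≤-antisym; +-mono-≤; m≤n+m; +-cancelˡ-≤; +-cancelʳ-≤; +-monoˡ-≤;
         module ≤-Reasoning)
open import Data.Product using (_,_; swap; proj₁; proj₂)
open import Data.Sum using (_⊎_; inj₁; inj₂)
open import Function using (_∘_)
open import Relation.Binary.PropositionalEquality
  using (_≢_; refl; sym; trans; cong; cong₂; subst; module ≡-Reasoning)
open import Relation.Nullary using (¬_; yes; no)
open import Relation.Nullary.Decidable using (⌊_⌋)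

-- Proposition 11.  Let T be an acyclic transversal of (X,H)/v in an
-- uncolorable, degree-feasible cover.
--   Step 1.  For x ∈ X_v, T ∪ {x} is a transversal of D; it would be acyclic
--            if x had no out-neighbour in T, so every x ∈ X_v has one.
--   Step 2.  Double counting the arcs from X_v into T: their ends lie in T
--            over out-neighbours of v, pairwise distinct (matching) and in
--            distinct fibres (transversal), so |X_v| ≤ #arcs ≤ d⁺(v) ≤ |X_v|.
--            Tightness gives exactly one out-neighbour in T for each x ∈ X_v,
--            and an in-neighbour in X_v for each relevant vertex of T.
--   Step 3.  If x ∈ X_v → c ∈ T ∩ X_u, then T - c + x is an acyclic
--            transversal of (X,H)/u; part (a) for it forbids a second
--            in-neighbour of c, i.e. any in-neighbour of c in T.
-- The in-degree statements and part (c) follow by reversing all arcs.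

variable
  n m : ℕ
  D : Digraph n
  H : Digraph m
  p : Fin m → Fin n
  S T T₀ T₁ : Fin m → Bool
  u v : Fin n
  a c x y : Fin m

∧-elimˡ : ∀ {a c} → a ∧ c ≡ true → a ≡ true
∧-elimˡ {true} _ = refl

∧-elimʳ : ∀ {a c} → a ∧ c ≡ true → c ≡ true
∧-elimʳ {true} e = e

∧-intro : ∀ {a c} → a ≡ true → c ≡ true → a ∧ c ≡ true
∧-intro refl e = e

false≢true : ¬ (false ≡ true)
false≢true ()

≟-sound : ∀ {k} {a c : Fin k} → ⌊ a ≟ c ⌋ ≡ true → a ≡ c
≟-sound {a = a} {c} e with a ≟ c
... | yes a≡c = a≡c

≟-complete : ∀ {k} {a c : Fin k} → a ≡ c → ⌊ a ≟ c ⌋ ≡ true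
≟-complete {a = a} {c} a≡c with a ≟ c
... | yes _ = refl
... | no a≢c = ⊥-elim (a≢c a≡c)

𝟙 : Bool → ℕ
𝟙 c = if c then 1 else 0

𝟙-≤ : ∀ {c k} → (c ≡ true → 1 ≤ k) → 𝟙 c ≤ k
𝟙-≤ {true} pos = pos refl
𝟙-≤ {false} _ = z≤n

count≡sum : ∀ {k} (f : Fin k → Bool) → count f ≡ sum (𝟙 ∘ f)
count≡sum {zero} f = refl
count≡sum {suc k} f = cong (𝟙 (f zero) +_) (count≡sum (f ∘ suc))

sum-mono : ∀ {k} (f g : Fin k → ℕ) → (∀ i → f i ≤ g i) → sum f ≤ sum g
sum-mono {zero} f g f≤g = z≤n
sum-mono {suc k} f g f≤g = +-mono-≤ (f≤g zero) (sum-mono (f ∘ suc) (g ∘ suc) (f≤g ∘ suc))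

sum-tight : ∀ {k} (f g : Fin k → ℕ) → (∀ i → f i ≤ g i) → sum g ≤ sum f → ∀ i → f i ≡ g i
sum-tight {suc k} f g f≤g Σg≤Σf = tight
  where
  tail≤ : sum (f ∘ suc) ≤ sum (g ∘ suc)
  tail≤ = sum-mono (f ∘ suc) (g ∘ suc) (f≤g ∘ suc)
  tail≥ : sum (g ∘ suc) ≤ sum (f ∘ suc)
  tail≥ = +-cancelˡ-≤ (g zero) _ _ (≤-trans Σg≤Σf (+-monoˡ-≤ (sum (f ∘ suc)) (f≤g zero)))
  head≥ : g zero ≤ f zero
  head≥ = +-cancelʳ-≤ (sum (g ∘ suc)) _ _
            (≤-trans Σg≤Σf (≤-reflexive (cong (f zero +_) (≤-antisym tail≤ tail≥))))
  tight : ∀ i → f i ≡ g i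
  tight zero = ≤-antisym (f≤g zero) head≥
  tight (suc i) = sum-tight (f ∘ suc) (g ∘ suc) (f≤g ∘ suc) tail≥ i

count-cong : ∀ {k} (f g : Fin k → Bool) → (∀ i → f i ≡ g i) → count f ≡ count g
count-cong {zero} f g f≗g = refl
count-cong {suc k} f g f≗g =
  cong₂ _+_ (cong 𝟙 (f≗g zero)) (count-cong (f ∘ suc) (g ∘ suc) (f≗g ∘ suc))

count-empty : ∀ {k} (f : Fin k → Bool) → (∀ i → f i ≡ false) → count f ≡ 0
count-empty {zero} f none = refl
count-empty {suc k} f none rewrite none zero = count-empty (f ∘ suc) (none ∘ suc)

count-positive : ∀ {k} (f : Fin k → Bool) (i : Fin k) → f i ≡ true → 1 ≤ count f
count-positive f zero fi rewrite fi = s≤s z≤n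
count-positive f (suc i) fi = ≤-trans (count-positive (f ∘ suc) i fi) (m≤n+m _ (𝟙 (f zero)))

count-witness : ∀ {k} (f : Fin k → Bool) → 1 ≤ count f → Σ (Fin k) λ i → f i ≡ true
count-witness {suc k} f pos with f zero in f0
... | true = zero , f0
... | false with count-witness (f ∘ suc) pos
...   | i , fi = suc i , fi

count-zero⇒false : ∀ {k} (f : Fin k → Bool) → count f ≡ 0 → ∀ i → f i ≡ false
count-zero⇒false f none i = ¬-not λ fi → 1≰0 (≤-trans (count-positive f i fi) (≤-reflexive none))
  where
  1≰0 : ¬ (1 ≤ 0)
  1≰0 ()

Subsingleton : ∀ {k} → (Fin k → Bool) → Set
Subsingleton f = ∀ i j → f i ≡ true → f j ≡ true → i ≡ j

count-subsingleton : ∀ {k} (f : Fin k → Bool) → Subsingleton f → count f ≤ 1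
count-subsingleton {zero} f uniq = z≤n
count-subsingleton {suc k} f uniq with f zero in f0
... | true = ≤-reflexive (cong suc (count-empty (f ∘ suc) λ i →
               ¬-not λ fi → zero≢suc (uniq zero (suc i) f0 fi)))
  where
  zero≢suc : ∀ {i : Fin k} → ¬ (zero ≡ suc i)
  zero≢suc ()
... | false = count-subsingleton (f ∘ suc) λ i j fi fj → suc-injective (uniq (suc i) (suc j) fi fj)

count-≤𝟙 : ∀ {k} (f : Fin k → Bool) (s : Bool)
  → (∀ i → f i ≡ true → s ≡ true) → Subsingleton f → count f ≤ 𝟙 s
count-≤𝟙 f true _ uniq = count-subsingleton f uniq
count-≤𝟙 f false f⇒s _ = ≤-reflexive (count-empty f λ i → ¬-not λ fi → false≢true (f⇒s i fi))

count-one : ∀ {k} (f : Fin k → Bool) (i : Fin k) → f i ≡ true → (∀ j → f j ≡ true → j ≡ i)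
  → count f ≡ 1
count-one f i fi only = ≤-antisym
  (count-subsingleton f λ j j′ fj fj′ → trans (only j fj) (sym (only j′ fj′)))
  (count-positive f i fi)

count-one-unique : ∀ {k} (f : Fin k → Bool) → count f ≡ 1 → Subsingleton f
count-one-unique {suc k} f one with f zero in f0
... | true = λ i j fi fj → trans (at-zero i fi) (sym (at-zero j fj))
  where
  at-zero : ∀ i → f i ≡ true → i ≡ zero
  at-zero zero _ = refl
  at-zero (suc i) fi =
    ⊥-elim (false≢true (trans (sym (count-zero⇒false (f ∘ suc) (ℕₚ.suc-injective one) i)) fi))
... | false = both-suc
  where
  both-suc : Subsingleton f
  both-suc zero _ fi _ = ⊥-elim (false≢true (trans (sym f0) fi))
  both-suc (suc i) zero _ fj = ⊥-elim (false≢true (trans (sym f0) fj))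
  both-suc (suc i) (suc j) fi fj = cong suc (count-one-unique (f ∘ suc) one i j fi fj)

count-point : ∀ {k} (a : Fin k) (c : Bool) → count (λ u → ⌊ a ≟ u ⌋ ∧ c) ≡ 𝟙 c
count-point a false = count-empty _ (λ u → ∧-zeroʳ ⌊ a ≟ u ⌋)
count-point a true = count-one _ a (∧-intro (≟-complete refl) refl) (λ u e → sym (≟-sound (∧-elimˡ e)))

count-comm : ∀ {k l} (R : Fin k → Fin l → Bool)
  → sum (λ i → count (R i)) ≡ sum (λ j → count (λ i → R i j))
count-comm R = begin
  sum (λ i → count (R i))                  ≡⟨ sum-cong-≗ (λ i → count≡sum (R i)) ⟩
  sum (λ i → sum (λ j → 𝟙 (R i j)))        ≡⟨ ∑-comm (λ i j → 𝟙 (R i j)) ⟩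
  sum (λ j → sum (λ i → 𝟙 (R i j)))        ≡⟨ sum-cong-≗ (λ j → count≡sum (λ i → R i j)) ⟨
  sum (λ j → count (λ i → R i j))          ∎
  where open ≡-Reasoning

-- Counting along a map: if `p` is injective on the truth set of `f` and
-- maps it into the truth set of `q`, then `f` has at most as many elements as `q`.
-- (Split `f` into the fibres of `p` and count each fibre against `q`.)
count-fibres : ∀ {k l} (p : Fin k → Fin l) (f : Fin k → Bool) (q : Fin l → Bool)
  → (∀ i → f i ≡ true → q (p i) ≡ true)
  → (∀ i j → f i ≡ true → f j ≡ true → p i ≡ p j → i ≡ j)
  → count f ≤ count q
count-fibres {k} {l} p f q f⇒q inj = begin
  count f                                    ≡⟨ count≡sum f ⟩
  sum (𝟙 ∘ f)                                ≡⟨ sum-cong-≗ (λ i → count-point (p i) (f i)) ⟨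
  sum (λ i → count (λ u → inFibre u i))      ≡⟨ count-comm (λ i u → inFibre u i) ⟩
  sum (λ u → count (inFibre u))              ≤⟨ sum-mono _ _ fibre-bound ⟩
  sum (𝟙 ∘ q)                                ≡⟨ count≡sum q ⟨
  count q                                    ∎
  where
  open ≤-Reasoning
  inFibre : Fin l → Fin k → Bool
  inFibre u i = ⌊ p i ≟ u ⌋ ∧ f i
  fibre⇒q : ∀ u i → inFibre u i ≡ true → q u ≡ true
  fibre⇒q u i e = subst (λ w → q w ≡ true) (≟-sound (∧-elimˡ e)) (f⇒q i (∧-elimʳ e))
  fibre-unique : ∀ u → Subsingleton (inFibre u)
  fibre-unique u i j ei ej =
    inj i j (∧-elimʳ ei) (∧-elimʳ ej) (trans (≟-sound (∧-elimˡ ei)) (sym (≟-sound (∧-elimˡ ej))))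
  fibre-bound : ∀ u → count (inFibre u) ≤ 𝟙 (q u)
  fibre-bound u = count-≤𝟙 (inFibre u) (q u) (fibre⇒q u) (fibre-unique u)

arc-distinct : arc H a c ≡ true → a ≢ c
arc-distinct {H = H} {a = a} e refl = false≢true (trans (sym (loopless H a)) e)

OutNeighbour : Digraph m → (Fin m → Bool) → Fin m → Set
OutNeighbour {m} H T x = Σ (Fin m) λ y → (T y ≡ true) × (arc H x y ≡ true)

walk-start : TWalk H T a c → T a ≡ true
walk-start (step ta _ _) = ta
walk-start (cons ta _ _) = ta

walk-first-arc : TWalk H T a c → OutNeighbour H T a
walk-first-arc (step _ tc ac) = _ , tc , ac
walk-first-arc (cons _ ay W) = _ , walk-start W , ay

walk-through : (∀ y → T₁ y ≡ true → y ≢ x → T₀ y ≡ true)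
  → TWalk H T₁ a c → TWalk H T₀ a c ⊎ (OutNeighbour H T₁ x ⊎ c ≡ x)
walk-through {x = x} sub (step {a} {c} ta tc ac) with a ≟ x | c ≟ x
... | yes refl | _ = inj₂ (inj₁ (c , tc , ac))
... | no _ | yes c≡x = inj₂ (inj₂ c≡x)
... | no a≢x | no c≢x = inj₁ (step (sub a ta a≢x) (sub c tc c≢x) ac)
walk-through {x = x} sub (cons {a} ta ay W) with a ≟ x | walk-through sub W
... | yes refl | _ = inj₂ (inj₁ (_ , walk-start W , ay))
... | no _ | inj₂ r = inj₂ r
... | no a≢x | inj₁ W₀ = inj₁ (cons (sub a ta a≢x) ay W₀)

-- If T₁ ⊆ T₀ ∪ {x} and H[T₀] is acyclic, then so is H[T₁] as long as x has
-- no out-neighbour in T₁: a cycle would have to pass through x.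
acyclic-extend : (∀ y → T₁ y ≡ true → y ≢ x → T₀ y ≡ true) → ¬ OutNeighbour H T₁ x
  → AcyclicIn H T₀ → AcyclicIn H T₁
acyclic-extend sub no-out acyclic₀ c W with walk-through sub W
... | inj₁ W₀ = acyclic₀ c W₀
... | inj₂ (inj₁ out) = no-out out
... | inj₂ (inj₂ refl) = no-out (walk-first-arc W)

reverse : Digraph n → Digraph n
reverse D = record { arc = λ a c → arc D c a ; loopless = loopless D }

walk-snoc : TWalk H T a c → T x ≡ true → arc H c x ≡ true → TWalk H T a x
walk-snoc (step ta tc ac) tx cx = cons ta ac (step tc tx cx)
walk-snoc (cons ta ay W) tx cx = cons ta ay (walk-snoc W tx cx)

walk-reverse : TWalk H T a c → TWalk (reverse H) T c a
walk-reverse (step ta tc ac) = step tc ta ac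
walk-reverse (cons ta ay W) = walk-snoc (walk-reverse W) ta ay

reverse-cover : IsCover D p H → IsCover (reverse D) p (reverse H)
reverse-cover cov = record
  { independent = λ a c e → independent c a e ∘ sym
  ; arises      = λ a c → arises c a
  ; matchingOut = λ a c c′ e e′ → matchingIn c c′ a e e′
  ; matchingIn  = λ a a′ c e e′ → matchingOut c a a′ e e′
  }
  where open IsCover cov

reverse-feasible : DegreeFeasible D p → DegreeFeasible (reverse D) p
reverse-feasible feasible v = swap (feasible v)

reverse-transversal : AcyclicTransversalOn S p H T → AcyclicTransversalOn S p (reverse H) T
reverse-transversal t = record
  { inS = inS ; one = one ; acyclic = λ x W → acyclic x (walk-reverse W) }
  where open AcyclicTransversalOn t

-- What Proposition 11 uses about a minimal uncolorable configuration:
-- the cover is degree-feasible and has no acyclic transversal.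
record UncolorableCover (D : Digraph n) (p : Fin m → Fin n) (H : Digraph m) : Set where
  field
    cover       : IsCover D p H
    feasible    : DegreeFeasible D p
    uncolorable : ¬ Colorable p H

reverse-uncolorable : UncolorableCover D p H → UncolorableCover (reverse D) p (reverse H)
reverse-uncolorable {D = D} {p = p} {H = H} U = record
  { cover       = reverse-cover {D = D} {H = H} cover
  ; feasible    = reverse-feasible {D = D} {p = p} feasible
  ; uncolorable = λ (T , t) → uncolorable (T , reverse-transversal {H = reverse H} t)
  }
  where open UncolorableCover U

minusV-intro : u ≢ v → minusV v u ≡ true
minusV-intro {u = u} {v = v} u≢v with u ≟ v
... | yes u≡v = ⊥-elim (u≢v u≡v)
... | no _ = refl

minusV-elim : minusV v u ≡ true → u ≢ v
minusV-elim {v = v} {u = u} e with u ≟ v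
... | no u≢v = u≢v

quot-avoids : AcyclicTransversalQuot p H v T → T a ≡ true → p a ≢ v
quot-avoids t ta = minusV-elim (AcyclicTransversalOn.inS t _ ta)

fibreCount : (Fin m → Fin n) → (Fin m → Bool) → Fin n → ℕ
fibreCount p T u = count (λ y → T y ∧ ⌊ p y ≟ u ⌋)

transversal-unique : AcyclicTransversalOn S p H T → T a ≡ true → T c ≡ true → p a ≡ p c → a ≡ c
transversal-unique {p = p} {T = T} {a = a} {c = c} t ta tc pa≡pc =
  count-one-unique (λ y → T y ∧ ⌊ p y ≟ p a ⌋) (one (p a) (inS a ta)) a c
    (∧-intro ta (≟-complete refl)) (∧-intro tc (≟-complete (sym pa≡pc)))
  where open AcyclicTransversalOn t

fibreCount-local : ∀ T₀ T₁ → (∀ y → p y ≡ u → T₀ y ≡ T₁ y)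
  → fibreCount p T₀ u ≡ fibreCount p T₁ u
fibreCount-local {p = p} {u = u} T₀ T₁ agree = count-cong _ _ same
  where
  same : ∀ y → (T₀ y ∧ ⌊ p y ≟ u ⌋) ≡ (T₁ y ∧ ⌊ p y ≟ u ⌋)
  same y with p y ≟ u
  ... | yes py≡u = cong (_∧ true) (agree y py≡u)
  ... | no _ = trans (∧-zeroʳ (T₀ y)) (sym (∧-zeroʳ (T₁ y)))

insert : Fin m → (Fin m → Bool) → Fin m → Bool
insert x T y = ⌊ y ≟ x ⌋ ∨ T y

remove : Fin m → (Fin m → Bool) → Fin m → Bool
remove x T y = not ⌊ y ≟ x ⌋ ∧ T y

swap-in : Fin m → Fin m → (Fin m → Bool) → Fin m → Bool
swap-in x c T = insert x (remove c T)

insert-here : insert x T x ≡ true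
insert-here {x = x} {T = T} = cong (_∨ T x) (≟-complete refl)

insert-there : T a ≡ true → insert x T a ≡ true
insert-there {T = T} {a = a} {x = x} ta = trans (cong (⌊ a ≟ x ⌋ ∨_) ta) (∨-zeroʳ _)

insert-elim : insert x T a ≡ true → a ≡ x ⊎ T a ≡ true
insert-elim {x = x} {a = a} e with a ≟ x
... | yes a≡x = inj₁ a≡x
... | no _ = inj₂ e

insert-away : a ≢ x → insert x T a ≡ T a
insert-away {a = a} {x = x} a≢x with a ≟ x
... | yes a≡x = ⊥-elim (a≢x a≡x)
... | no _ = refl

remove-away : a ≢ x → remove x T a ≡ T a
remove-away {a = a} {x = x} a≢x with a ≟ x
... | yes a≡x = ⊥-elim (a≢x a≡x)
... | no _ = refl

remove-intro : T a ≡ true → a ≢ x → remove x T a ≡ true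
remove-intro {T = T} ta a≢x = trans (remove-away {T = T} a≢x) ta

remove-elim : remove x T a ≡ true → T a ≡ true × a ≢ x
remove-elim {x = x} {a = a} e with a ≟ x
... | no a≢x = e , a≢x

insert-fibre-new : ∀ x T → (∀ y → T y ≡ true → p y ≢ p x) → fibreCount p (insert x T) (p x) ≡ 1
insert-fibre-new {p = p} x T empty =
  count-one _ x (∧-intro (insert-here {x = x} {T = T}) (≟-complete {a = p x} refl)) only-x
  where
  only-x : ∀ y → (insert x T y ∧ ⌊ p y ≟ p x ⌋) ≡ true → y ≡ x
  only-x y e with insert-elim {T = T} (∧-elimˡ e)
  ... | inj₁ y≡x = y≡x
  ... | inj₂ ty = ⊥-elim (empty y ty (≟-sound (∧-elimʳ e)))

insert-fibre-other : ∀ x T → u ≢ p x → fibreCount p (insert x T) u ≡ fibreCount p T u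
insert-fibre-other {u = u} {p = p} x T u≢px = fibreCount-local (insert x T) T λ y py≡u →
  insert-away {T = T} λ y≡x → u≢px (trans (sym py≡u) (cong p y≡x))

remove-fibre-other : ∀ x T → u ≢ p x → fibreCount p (remove x T) u ≡ fibreCount p T u
remove-fibre-other {u = u} {p = p} x T u≢px = fibreCount-local (remove x T) T λ y py≡u →
  remove-away {T = T} λ y≡x → u≢px (trans (sym py≡u) (cong p y≡x))

extend-transversal : AcyclicTransversalQuot p H v T → p x ≡ v → ¬ OutNeighbour H (insert x T) x
  → AcyclicTransversal p H (insert x T)
extend-transversal {p = p} {H = H} {v = v} {T = T} {x = x} t px no-out = record
  { inS     = λ _ _ → refl
  ; one     = λ u _ → fibre-one u
  ; acyclic = acyclic-extend inside no-out acyclic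
  }
  where
  open AcyclicTransversalOn t
  inside : ∀ y → insert x T y ≡ true → y ≢ x → T y ≡ true
  inside y e y≢x = trans (sym (insert-away {T = T} y≢x)) e
  fibre-one : ∀ u → fibreCount p (insert x T) u ≡ 1
  fibre-one u with u ≟ v
  ... | yes refl = subst (λ w → fibreCount p (insert x T) w ≡ 1) px
                     (insert-fibre-new x T λ y ty py≡px → quot-avoids t ty (trans py≡px px))
  ... | no u≢v = trans (insert-fibre-other x T (λ u≡px → u≢v (trans u≡px px))) (one u (minusV-intro u≢v))

has-out-neighbour : UncolorableCover D p H → AcyclicTransversalQuot p H v T → p x ≡ v
  → 1 ≤ count (λ y → arc H x y ∧ T y)
has-out-neighbour {H = H} {T = T} {x = x} U t px with count (λ y → arc H x y ∧ T y) in none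
... | suc _ = s≤s z≤n
... | zero = ⊥-elim (uncolorable (insert x T , extend-transversal t px no-out))
  where
  open UncolorableCover U
  no-out : ¬ OutNeighbour H (insert x T) x
  no-out (y , t′y , xy) with insert-elim {T = T} t′y
  ... | inj₁ y≡x = arc-distinct {H = H} xy (sym y≡x)
  ... | inj₂ ty = false≢true (trans (sym (count-zero⇒false _ none y)) (∧-intro xy ty))

-- Step 2. Double counting the arcs from X_v to T.  Every x ∈ X_v sends at
-- least one arc into T (Step 1); an arc xy with y ∈ T forces p y ∈ N⁺_D(v), and
-- distinct arcs end at distinct y (matching), which lie in distinct fibres
-- (transversal).  So  |X_v| ≤ #arcs ≤ d⁺_D(v) ≤ |X_v|, and all bounds are tight.
module DoubleCounting {D : Digraph n} {p : Fin m → Fin n} {H : Digraph m} (U : UncolorableCover D p H)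
                      {v : Fin n} {T : Fin m → Bool} (t : AcyclicTransversalQuot p H v T) where
  open UncolorableCover U
  open IsCover cover

  inXv : Fin m → Bool
  inXv x = ⌊ p x ≟ v ⌋

  edge : Fin m → Fin m → Bool
  edge x y = inXv x ∧ (arc H x y ∧ T y)

  hit : Fin m → Bool
  hit y = T y ∧ arc D v (p y)

  edge-elim : edge x y ≡ true → (p x ≡ v) × (arc H x y ≡ true) × (T y ≡ true)
  edge-elim {x = x} {y = y} e =
    ≟-sound (∧-elimˡ {inXv x} e) , ∧-elimˡ {arc H x y} e′ , ∧-elimʳ {arc H x y} e′
    where
    e′ : (arc H x y ∧ T y) ≡ true
    e′ = ∧-elimʳ {inXv x} e

  row : Fin m → ℕ
  row x = count (edge x)

  column : Fin m → ℕ
  column y = count (λ x → edge x y)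

  row-out : p x ≡ v → row x ≡ count (λ y → arc H x y ∧ T y)
  row-out {x = x} px = count-cong _ _ λ y → cong (_∧ (arc H x y ∧ T y)) (≟-complete px)

  row-lower : ∀ x → 𝟙 (inXv x) ≤ row x
  row-lower x = 𝟙-≤ λ e → let px = ≟-sound e in
    ≤-trans (has-out-neighbour U t px) (≤-reflexive (sym (row-out px)))

  column-upper : ∀ y → column y ≤ 𝟙 (hit y)
  column-upper y = count-≤𝟙 _ (hit y) hits unique
    where
    hits : ∀ x → edge x y ≡ true → hit y ≡ true
    hits x e with edge-elim e
    ... | px , xy , ty = ∧-intro ty (subst (λ w → arc D w (p y) ≡ true) px (arises x y xy))
    unique : Subsingleton (λ x → edge x y)
    unique x x′ e e′ with edge-elim e | edge-elim e′
    ... | px , xy , _ | px′ , x′y , _ = matchingIn x x′ y xy x′y (trans px (sym px′))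

  hits-bound : sum (𝟙 ∘ hit) ≤ sum (𝟙 ∘ inXv)
  hits-bound = begin
    sum (𝟙 ∘ hit)    ≡⟨ count≡sum hit ⟨
    count hit        ≤⟨ count-fibres p hit (arc D v) (λ _ → ∧-elimʳ)
                          (λ y y′ e e′ → transversal-unique t (∧-elimˡ e) (∧-elimˡ e′)) ⟩
    outdeg D v       ≤⟨ proj₁ (feasible v) ⟩
    fibreSize p v    ≡⟨ count≡sum inXv ⟩
    sum (𝟙 ∘ inXv)   ∎
    where open ≤-Reasoning

  rows-bound : sum row ≤ sum (𝟙 ∘ inXv)
  rows-bound = begin
    sum row          ≡⟨ count-comm edge ⟩
    sum column       ≤⟨ sum-mono column (𝟙 ∘ hit) column-upper ⟩
    sum (𝟙 ∘ hit)    ≤⟨ hits-bound ⟩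
    sum (𝟙 ∘ inXv)   ∎
    where open ≤-Reasoning

  columns-bound : sum (𝟙 ∘ hit) ≤ sum column
  columns-bound = begin
    sum (𝟙 ∘ hit)    ≤⟨ hits-bound ⟩
    sum (𝟙 ∘ inXv)   ≤⟨ sum-mono (𝟙 ∘ inXv) row row-lower ⟩
    sum row          ≡⟨ count-comm edge ⟩
    sum column       ∎
    where open ≤-Reasoning

  out-unique : p x ≡ v → count (λ y → arc H x y ∧ T y) ≡ 1
  out-unique {x = x} px = begin
    count (λ y → arc H x y ∧ T y) ≡⟨ row-out px ⟨
    row x                         ≡⟨ sum-tight (𝟙 ∘ inXv) row row-lower rows-bound x ⟨
    𝟙 (inXv x)                    ≡⟨ cong 𝟙 (≟-complete px) ⟩
    1                             ∎
    where open ≡-Reasoning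

  in-neighbour : arc D v (p y) ≡ true → T y ≡ true
    → Σ (Fin m) λ x → (p x ≡ v) × (arc H x y ≡ true)
  in-neighbour {y = y} dv ty with count-witness (λ x → edge x y) (≤-reflexive (sym column-one))
    where
    column-one : column y ≡ 1
    column-one = trans (sum-tight column (𝟙 ∘ hit) column-upper columns-bound y)
                       (cong 𝟙 (∧-intro ty dv))
  ... | x , e = x , proj₁ (edge-elim e) , proj₁ (proj₂ (edge-elim e))

open DoubleCounting using (out-unique; in-neighbour)

in-unique : UncolorableCover D p H → AcyclicTransversalQuot p H v T → p x ≡ v
  → count (λ y → arc H y x ∧ T y) ≡ 1
in-unique {H = H} U t = out-unique (reverse-uncolorable U) (reverse-transversal {H = H} t)

-- Step 3. Exchange: if x ∈ X_v has c ∈ T ∩ X_u (u ≠ v) as its only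
-- out-neighbour in T, then T - c + x is an acyclic transversal of (X,H)/u;
-- acyclicity holds because x has no out-neighbour left.
exchange : AcyclicTransversalQuot p H v T → p x ≡ v → p c ≡ u → u ≢ v → T c ≡ true
  → (∀ y → T y ≡ true → arc H x y ≡ true → y ≡ c)
  → AcyclicTransversalQuot p H u (swap-in x c T)
exchange {p = p} {H = H} {v = v} {T = T} {x = x} {c = c} {u = u} t px pc u≢v tc only-c = record
  { inS     = avoids-u
  ; one     = λ w w≢u → fibre-one w (minusV-elim w≢u)
  ; acyclic = acyclic-extend inside no-out acyclic
  }
  where
  open AcyclicTransversalOn t

  avoids-u : ∀ y → swap-in x c T y ≡ true → minusV u (p y) ≡ true
  avoids-u y e with insert-elim {x = x} {T = remove c T} {a = y} e
  ... | inj₁ refl = minusV-intro λ px≡u → u≢v (trans (sym px≡u) px)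
  ... | inj₂ r with remove-elim {T = T} r
  ...   | ty , y≢c = minusV-intro λ py≡u → y≢c (transversal-unique t ty tc (trans py≡u (sym pc)))

  fibre-one : ∀ w → w ≢ u → fibreCount p (swap-in x c T) w ≡ 1
  fibre-one w w≢u with w ≟ v
  ... | yes refl = subst (λ z → fibreCount p (swap-in x c T) z ≡ 1) px
                     (insert-fibre-new x (remove c T) λ y r py≡px →
                        quot-avoids t (proj₁ (remove-elim {T = T} r)) (trans py≡px px))
  ... | no w≢v = begin
    fibreCount p (swap-in x c T) w  ≡⟨ insert-fibre-other x (remove c T) (λ w≡px → w≢v (trans w≡px px)) ⟩
    fibreCount p (remove c T) w     ≡⟨ remove-fibre-other c T (λ w≡pc → w≢u (trans w≡pc pc)) ⟩
    fibreCount p T w                ≡⟨ one w (minusV-intro w≢v) ⟩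
    1                               ∎
    where open ≡-Reasoning

  inside : ∀ y → swap-in x c T y ≡ true → y ≢ x → T y ≡ true
  inside y e y≢x = proj₁ (remove-elim {T = T} (trans (sym (insert-away {T = remove c T} y≢x)) e))

  no-out : ¬ OutNeighbour H (swap-in x c T) x
  no-out (y , e , xy) with insert-elim {x = x} {T = remove c T} {a = y} e
  ... | inj₁ y≡x = arc-distinct {H = H} xy (sym y≡x)
  ... | inj₂ r with remove-elim {T = T} r
  ...   | ty , y≢c = y≢c (only-c y ty xy)

-- Otherwise, after the exchange of Step 3, c
-- would have two in-neighbours (x and that vertex) in T - c + x,
-- contradicting part (a) for the transversal T - c + x of (X,H)/p(c).
no-in-neighbour : UncolorableCover D p H → AcyclicTransversalQuot p H v T
  → p x ≡ v → arc H x c ≡ true → p c ≢ v → T c ≡ true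
  → ∀ y → T y ≡ true → arc H y c ≡ false
no-in-neighbour {p = p} {H = H} {v = v} {T = T} {x = x} {c = c} U t px xc pc≢v tc y ty =
  ¬-not λ yc → quot-avoids t (subst (λ z → T z ≡ true) (y≡x yc) ty) px
  where
  only-c : ∀ z → T z ≡ true → arc H x z ≡ true → z ≡ c
  only-c z tz xz = count-one-unique _ (out-unique U t px) z c (∧-intro xz tz) (∧-intro xc tc)
  t′ : AcyclicTransversalQuot p H (p c) (swap-in x c T)
  t′ = exchange t px refl pc≢v tc only-c
  y≡x : arc H y c ≡ true → y ≡ x
  y≡x yc = count-one-unique (λ z → arc H z c ∧ swap-in x c T z) (in-unique U t′ refl) y x
    (∧-intro yc (insert-there {T = remove c T} (remove-intro {T = T} ty (arc-distinct {H = H} yc))))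
    (∧-intro xc (insert-here {x = x} {T = remove c T}))

out-neighbour-of-v : UncolorableCover D p H → AcyclicTransversalQuot p H v T
  → arc D v u ≡ true → p c ≡ u → T c ≡ true
  → (Σ (Fin m) λ x → (p x ≡ v) × (arc H x c ≡ true)) × (∀ y → T y ≡ true → arc H y c ≡ false)
out-neighbour-of-v {D = D} {p = p} {v = v} {c = c} U t dv pc tc
  with in-neighbour U t (subst (λ z → arc D v z ≡ true) (sym pc) dv) tc
... | x , px , xc = (x , px , xc) , no-in-neighbour U t px xc pc≢v tc
  where
  pc≢v : p c ≢ v
  pc≢v pc≡v = arc-distinct {H = D} dv (trans (sym pc≡v) pc)

-- Proposition 11: (a) and (b) as above; (c) is (b) for the reversed cover,
-- in which arcs into X_v become arcs out of X_v.
proposition11 : ∀ {n m} (D : Digraph n) (p : Fin m → Fin n) (H : Digraph m)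
    → Connected D → IsCover D p H → DegreeFeasible D p
    → MinimalUncolorable p H
    → (v : Fin n) (T : Fin m → Bool) → AcyclicTransversalQuot p H v T
    → ((x : Fin m) → p x ≡ v
         → (count (λ y → arc H x y ∧ T y) ≡ 1) × (count (λ y → arc H y x ∧ T y) ≡ 1))
    × ((u : Fin n) (xu : Fin m) → arc D v u ≡ true → p xu ≡ u → T xu ≡ true
         → (Σ (Fin m) λ x → (p x ≡ v) × (arc H x xu ≡ true))
           × ((y : Fin m) → T y ≡ true → arc H y xu ≡ false))
    × ((w : Fin n) (xw : Fin m) → arc D w v ≡ true → p xw ≡ w → T xw ≡ true
         → (Σ (Fin m) λ x → (p x ≡ v) × (arc H xw x ≡ true))
           × ((y : Fin m) → T y ≡ true → arc H xw y ≡ false))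
proposition11 D p H _ cover feasible minimal v T t =
    (λ x px → out-unique U t px , in-unique U t px)
  , (λ u xu → out-neighbour-of-v U t)
  , (λ w xw → out-neighbour-of-v (reverse-uncolorable U) (reverse-transversal {H = H} t))
  where
  U : UncolorableCover D p H
  U = record { cover = cover ; feasible = feasible ; uncolorable = MinimalUncolorable.uncolorable minimal }
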